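{- For $w\in[0,1)\cap\mathbb{Q}$, let $\bar\gamma_w$ be the unique geodesic in $\mathbb{H}$ joining $w$ to $+\infty$. Let $w_1=p_1/q_1$ and $w_2=p_2/q_2$ be distinct elements of $(0,1)\cap\mathbb{Q}$ with $\gcd(p_i,q_i)=1$ and $q_i\ge 2$ for $i=1,2$. Then $\bar\gamma_{w_1}$ and $\bar\gamma_{w_2}$ project onto the same geodesic in $\mathcal{M}=\mathbb{H}/\mathrm{PSL}(2,\mathbb{Z})$ if and only if (1) $q_1=q_2=q$, and (2) $q$ divides $p_1p_2+1$.
   Context: $\mathbb{H}$ is the upper half-plane with the hyperbolic metric $ds^2=(dx^2+dy^2)/y^2$, $\mathrm{PSL}(2,\mathbb{Z})$ acts on it by linear fractional transformations, $\mathcal{M}=\mathbb{H}/\mathrm{PSL}(2,\mathbb{Z})$ with canonical projection $\pi:\mathbb{H}\to\mathcal{M}$; geodesics in $\mathcal{M}$ are images under $\pi$ of geodesics in $\mathbb{H}$. -}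

module Defs where

open import Data.Integer using (ℤ; +_; _+_; _*_; _-_; 1ℤ; 0ℤ)
open import Data.Nat as ℕ using (ℕ)
open import Data.Product using (Σ; _×_; _,_; ∃)
open import Data.Sum using (_⊎_)
open import Relation.Binary.PropositionalEquality using (_≡_)

-- Elements of SL(2,ℤ); PSL(2,ℤ) = SL(2,ℤ)/{±I} acts identically on the
-- boundary, so existence of an element of PSL(2,ℤ) with a property of its
-- action is the same as existence of such an element of SL(2,ℤ).
record SL2Z : Set where
  constructor mkSL2Z
  field
    a b c d : ℤ
    det : a * d - b * c ≡ 1ℤ

-- Points of the boundary ∂ℍ = ℙ¹(ℚ) ∪ ℝ restricted to ℙ¹(ℚ):
-- homogeneous coordinates [x : y] (x/y, with [1:0] = ∞).
Boundary : Set
Boundary = ℤ × ℤ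

_∼_ : Boundary → Boundary → Set
(x , y) ∼ (x' , y') = x * y' ≡ y * x'

∞ : Boundary
∞ = (1ℤ , 0ℤ)

frac : ℕ → ℕ → Boundary
frac p q = (+ p , + q)

act : SL2Z → Boundary → Boundary
act g (x , y) = (a * x + b * y , c * x + d * y)
  where open SL2Z g

-- A geodesic of ℍ joining two rational boundary points, given by its endpoints
-- (a geodesic of ℍ is uniquely determined by its unordered pair of endpoints).
Geodesic : Set
Geodesic = Boundary × Boundary

γ̄ : ℕ → ℕ → Geodesic
γ̄ p q = (frac p q , ∞)

MapsOnto : SL2Z → Geodesic → Geodesic → Set
MapsOnto g (e₁ , e₂) (f₁ , f₂) =
  (act g e₁ ∼ f₁ × act g e₂ ∼ f₂) ⊎ (act g e₁ ∼ f₂ × act g e₂ ∼ f₁)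

-- γ and γ' project onto the same geodesic of ℳ = ℍ/PSL(2,ℤ):
-- π(γ) = π(γ'), i.e. γ' = g·γ for some g ∈ PSL(2,ℤ).
SameProjection : Geodesic → Geodesic → Set
SameProjection γ γ' = Σ SL2Z λ g → MapsOnto g γ γ'

{-# OPTIONS --safe #-}
-- An element g = (a b ; c d) of SL(2,ℤ) carrying γ̄_{w₁} onto γ̄_{w₂} either fixes ∞ or
-- exchanges ∞ with the finite endpoint. If g fixes ∞ then c = 0 and a = d = ±1, so g is a
-- translation, and two distinct points of (0,1) never differ by an integer. Otherwise
-- g(p₁/q₁) = ∞ gives c p₁ + d q₁ = 0 and g(∞) = a/c = p₂/q₂; since the columns and rows of
-- g are coprime, |c| = q₁ and |c| = q₂. Clearing the denominator q² in ad − bc = 1 then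
-- yields p₁p₂ + 1 = −bc, a multiple of q. Conversely, if p₁p₂ + 1 = kq then
-- (p₂ −k ; q −p₁) lies in SL(2,ℤ) and exchanges ∞ with the finite endpoints.
module Submission where

open import Defs
open import Data.List.Base using ([]; _∷_)
open import Data.Product.Base using (_×_; _,_)
open import Data.Sum.Base using (_⊎_; inj₁; inj₂; [_,_]′)
open import Relation.Binary.PropositionalEquality
  using (_≡_; refl; sym; trans; cong; cong₂; subst; module ≡-Reasoning)

-- The integer operators are opened only inside this module, since the statement at the end
-- uses the natural-number ones.
module _ where
  open import Data.Integer.Base using (ℤ; +_; -[1+_]; ∣_∣; _+_; _*_; _-_; -_; 0ℤ; 1ℤ; NonZero)
  open import Data.Integer.Properties
    using ( *-identityʳ; *-zeroʳ; +-identityˡ; *-comm; *-cancelʳ-≡; i*j≢0; +-injective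
          ; pos-*; pos-+; abs-*; m-n≡m⊖n; ∣m⊝n∣≤m⊔n; ∣i∣≡0⇒i≡0; i-j≡0⇒i≡j)
  open import Data.Integer.Coprimality using (Coprime; coprime-divisor)
  open import Data.Integer.Divisibility.Signed using (_∣_; divides; ∣⇒∣ᵤ; ∣ᵤ⇒∣; ∣m∣n⇒∣m+n; ∣n⇒∣m*n)
  open import Data.Integer.Tactic.RingSolver using (solve)
  import Data.Nat.Base as ℕ
  import Data.Nat.Coprimality as ℕ using (Coprime; sym)
  import Data.Nat.Divisibility as ℕ using (_∣_; divides; ∣-antisym; ∣1⇒≡1; n∣m⇒m%n≡0)
  import Data.Nat.DivMod as ℕ using (m<n⇒m%n≡m)
  import Data.Nat.Properties as ℕ
    using (≤-<-trans; ⊔-lub; m*n≡1⇒m≡1; *-monoʳ-<; *-monoˡ-<; *-comm; m<n⇒n≢0)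
  open ≡-Reasoning

  <⇒nonZero : ∀ {m n} → m ℕ.< n → ℕ.NonZero n
  <⇒nonZero m<n = ℕ.≢-nonZero (ℕ.m<n⇒n≢0 m<n)

  combination≡1⇒coprime : ∀ {i j} u v → u * i + v * j ≡ 1ℤ → Coprime i j
  combination≡1⇒coprime u v eq {k} (k∣i , k∣j) = ℕ.∣1⇒≡1 (∣⇒∣ᵤ (subst (+ k ∣_) eq
    (∣m∣n⇒∣m+n (∣n⇒∣m*n u (∣ᵤ⇒∣ k∣i)) (∣n⇒∣m*n v (∣ᵤ⇒∣ k∣j)))))

  coprime∧i*l≡j*k⇒∣i∣≡∣k∣ : ∀ i j k l → Coprime i j → Coprime k l → i * l ≡ j * k → ∣ i ∣ ≡ ∣ k ∣
  coprime∧i*l≡j*k⇒∣i∣≡∣k∣ i j k l i⊥j k⊥l eq = ℕ.∣-antisym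
    (coprime-divisor i j k i⊥j (∣⇒∣ᵤ (divides l (trans (sym eq) (*-comm i l)))))
    (coprime-divisor k l i k⊥l (∣⇒∣ᵤ (divides j (trans (*-comm l i) eq))))

  ∣i∣≡∣j∣⇒i*i≡j*j : ∀ i j → ∣ i ∣ ≡ ∣ j ∣ → i * i ≡ j * j
  ∣i∣≡∣j∣⇒i*i≡j*j i j eq = begin
    i * i               ≡⟨ i*i≡∣i∣*∣i∣ i ⟩
    + (∣ i ∣ ℕ.* ∣ i ∣) ≡⟨ cong (λ n → + (n ℕ.* n)) eq ⟩
    + (∣ j ∣ ℕ.* ∣ j ∣) ≡⟨ i*i≡∣i∣*∣i∣ j ⟨
    j * j               ∎
    where
    i*i≡∣i∣*∣i∣ : ∀ i → i * i ≡ + (∣ i ∣ ℕ.* ∣ i ∣)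
    i*i≡∣i∣*∣i∣ (+ n)    = sym (pos-* n n)
    i*i≡∣i∣*∣i∣ -[1+ n ] = refl

  i*j≡1⇒i*i≡1 : ∀ {i j} → i * j ≡ 1ℤ → i * i ≡ 1ℤ
  i*j≡1⇒i*i≡1 {i} {j} eq =
    ∣i∣≡1⇒i*i≡1 {i} (ℕ.m*n≡1⇒m≡1 ∣ i ∣ ∣ j ∣ (trans (sym (abs-* i j)) (cong ∣_∣ eq)))
    where
    ∣i∣≡1⇒i*i≡1 : ∀ {i} → ∣ i ∣ ≡ 1 → i * i ≡ 1ℤ
    ∣i∣≡1⇒i*i≡1 {+ _}       refl = refl
    ∣i∣≡1⇒i*i≡1 { -[1+ _ ]} refl = refl

  pos-*+1 : ∀ m n → + (m ℕ.* n ℕ.+ 1) ≡ + m * + n + 1ℤ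
  pos-*+1 m n = trans (pos-+ (m ℕ.* n) 1) (cong (_+ 1ℤ) (pos-* m n))

  m<z∧n<z∧z∣m-n⇒m≡n : ∀ {m n z} → m ℕ.< z → n ℕ.< z → + z ∣ + m - + n → m ≡ n
  m<z∧n<z∧z∣m-n⇒m≡n {m} {n} {z} m<z n<z z∣m-n =
    +-injective (i-j≡0⇒i≡j (+ m) (+ n) (∣i∣≡0⇒i≡0 ∣m-n∣≡0))
    where
    instance
      z≢0 : ℕ.NonZero z
      z≢0 = <⇒nonZero m<z
    ∣m-n∣<z : ∣ + m - + n ∣ ℕ.< z
    ∣m-n∣<z = ℕ.≤-<-trans (subst (ℕ._≤ m ℕ.⊔ n) (cong ∣_∣ (sym (m-n≡m⊖n m n))) (∣m⊝n∣≤m⊔n m n))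
                          (ℕ.⊔-lub m<z n<z)
    ∣m-n∣≡0 : ∣ + m - + n ∣ ≡ 0
    ∣m-n∣≡0 = trans (sym (ℕ.m<n⇒m%n≡m ∣m-n∣<z)) (ℕ.n∣m⇒m%n≡0 _ z (∣⇒∣ᵤ z∣m-n))

  act-∞ : (g : SL2Z) → act g ∞ ≡ (SL2Z.a g , SL2Z.c g)
  act-∞ (mkSL2Z a b c d _) = cong₂ _,_ (solve (a ∷ b ∷ [])) (solve (c ∷ d ∷ []))

  ∼∞⇒denominator≡0 : ∀ x y → (x , y) ∼ ∞ → y ≡ 0ℤ
  ∼∞⇒denominator≡0 x y eq = begin
    y        ≡⟨ *-identityʳ y ⟨
    y * 1ℤ   ≡⟨ eq ⟨
    x * 0ℤ   ≡⟨ *-zeroʳ x ⟩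
    0ℤ       ∎

  fixes-∞⇒c≡0 : ∀ g → act g ∞ ∼ ∞ → SL2Z.c g ≡ 0ℤ
  fixes-∞⇒c≡0 g fix = ∼∞⇒denominator≡0 (SL2Z.a g) (SL2Z.c g) (subst (_∼ ∞) (act-∞ g) fix)

  fixes-∞⇒translation : ∀ g {x y x′ y′} → act g ∞ ∼ ∞ → act g (x , y) ∼ (x′ , y′) →
                        y * y′ ∣ y * x′ - x * y′
  fixes-∞⇒translation g@(mkSL2Z a b c d det) {x} {y} {x′} {y′} fix eq with fixes-∞⇒c≡0 g fix
  ... | refl = divides (a * b) (begin
    y * x′ - x * y′
      ≡⟨ solve (x ∷ y ∷ x′ ∷ y′ ∷ []) ⟩
    1ℤ * (y * x′) - x * y′
      ≡⟨ cong (λ t → t * (y * x′) - x * y′) ad≡1 ⟨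
    a * d * (y * x′) - x * y′
      ≡⟨ solve (a ∷ d ∷ x ∷ y ∷ x′ ∷ y′ ∷ []) ⟩
    a * ((0ℤ * x + d * y) * x′) - x * y′
      ≡⟨ cong (λ t → a * t - x * y′) eq ⟨
    a * ((a * x + b * y) * y′) - x * y′
      ≡⟨ solve (a ∷ b ∷ x ∷ y ∷ x′ ∷ y′ ∷ []) ⟩
    a * a * (x * y′) - x * y′ + a * b * (y * y′)
      ≡⟨ cong (λ t → t * (x * y′) - x * y′ + a * b * (y * y′)) a²≡1 ⟩
    1ℤ * (x * y′) - x * y′ + a * b * (y * y′)
      ≡⟨ solve (a ∷ b ∷ x ∷ y ∷ x′ ∷ y′ ∷ []) ⟩
    a * b * (y * y′)
      ∎)
    where
    ad≡1 : a * d ≡ 1ℤ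
    ad≡1 = begin
      a * d           ≡⟨ solve (a ∷ b ∷ d ∷ []) ⟩
      a * d - b * 0ℤ  ≡⟨ det ⟩
      1ℤ              ∎
    a²≡1 : a * a ≡ 1ℤ
    a²≡1 = i*j≡1⇒i*i≡1 {a} {d} ad≡1

  fixes-∞⇒same-fraction : ∀ g {p₁ q₁ p₂ q₂} → act g ∞ ∼ ∞ → act g (frac p₁ q₁) ∼ frac p₂ q₂ →
                          p₁ ℕ.< q₁ → p₂ ℕ.< q₂ → p₁ ℕ.* q₂ ≡ p₂ ℕ.* q₁
  fixes-∞⇒same-fraction g {p₁} {q₁} {p₂} {q₂} fix eq p₁<q₁ p₂<q₂ =
    trans (sym (m<z∧n<z∧z∣m-n⇒m≡n q₁p₂<q₁q₂ p₁q₂<q₁q₂ q₁q₂∣q₁p₂-p₁q₂)) (ℕ.*-comm q₁ p₂)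
    where
    q₁p₂<q₁q₂ : q₁ ℕ.* p₂ ℕ.< q₁ ℕ.* q₂
    q₁p₂<q₁q₂ = ℕ.*-monoʳ-< q₁ {{<⇒nonZero p₁<q₁}} p₂<q₂
    p₁q₂<q₁q₂ : p₁ ℕ.* q₂ ℕ.< q₁ ℕ.* q₂
    p₁q₂<q₁q₂ = ℕ.*-monoˡ-< q₂ {{<⇒nonZero p₂<q₂}} p₁<q₁
    q₁q₂∣q₁p₂-p₁q₂ : + (q₁ ℕ.* q₂) ∣ + (q₁ ℕ.* p₂) - + (p₁ ℕ.* q₂)
    q₁q₂∣q₁p₂-p₁q₂ rewrite pos-* q₁ q₂ | pos-* q₁ p₂ | pos-* p₁ q₂ = fixes-∞⇒translation g fix eq

  coprime-c-a : ∀ g → Coprime (SL2Z.c g) (SL2Z.a g)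
  coprime-c-a (mkSL2Z a b c d det) = combination≡1⇒coprime (- b) d (begin
    - b * c + d * a  ≡⟨ solve (a ∷ b ∷ c ∷ d ∷ []) ⟩
    a * d - b * c    ≡⟨ det ⟩
    1ℤ               ∎)

  coprime-c-[-d] : ∀ g → Coprime (SL2Z.c g) (- SL2Z.d g)
  coprime-c-[-d] (mkSL2Z a b c d det) = combination≡1⇒coprime (- b) (- a) (begin
    - b * c + - a * - d  ≡⟨ solve (a ∷ b ∷ c ∷ d ∷ []) ⟩
    a * d - b * c        ≡⟨ det ⟩
    1ℤ                   ∎)

  sends-to-∞⇒dy≡-cx : ∀ g {x y} → act g (x , y) ∼ ∞ → SL2Z.d g * y ≡ - (SL2Z.c g * x)
  sends-to-∞⇒dy≡-cx (mkSL2Z a b c d _) {x} {y} eq = begin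
    d * y
      ≡⟨ solve (c ∷ d ∷ x ∷ y ∷ []) ⟩
    c * x + d * y + - (c * x)
      ≡⟨ cong (_+ - (c * x)) (∼∞⇒denominator≡0 (a * x + b * y) (c * x + d * y) eq) ⟩
    0ℤ + - (c * x)
      ≡⟨ +-identityˡ (- (c * x)) ⟩
    - (c * x)
      ∎

  sends-∞-to⇒ay≡cx : ∀ g {x y} → act g ∞ ∼ (x , y) → SL2Z.a g * y ≡ SL2Z.c g * x
  sends-∞-to⇒ay≡cx g {x} {y} = subst (_∼ (x , y)) (act-∞ g)

  sends-to-∞⇒∣c∣≡∣y∣ : ∀ g {x y} → act g (x , y) ∼ ∞ → Coprime y x → ∣ SL2Z.c g ∣ ≡ ∣ y ∣
  sends-to-∞⇒∣c∣≡∣y∣ g@(mkSL2Z a b c d _) {x} {y} eq y⊥x =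
    coprime∧i*l≡j*k⇒∣i∣≡∣k∣ c (- d) y x (coprime-c-[-d] g) y⊥x (begin
      c * x        ≡⟨ solve (c ∷ x ∷ []) ⟩
      - - (c * x)  ≡⟨ cong -_ (sends-to-∞⇒dy≡-cx g eq) ⟨
      - (d * y)    ≡⟨ solve (d ∷ y ∷ []) ⟩
      - d * y      ∎)

  sends-∞-to⇒∣c∣≡∣y∣ : ∀ g {x y} → act g ∞ ∼ (x , y) → Coprime y x → ∣ SL2Z.c g ∣ ≡ ∣ y ∣
  sends-∞-to⇒∣c∣≡∣y∣ g {x} {y} eq y⊥x =
    coprime∧i*l≡j*k⇒∣i∣≡∣k∣ (SL2Z.c g) (SL2Z.a g) y x (coprime-c-a g) y⊥x (sym (sends-∞-to⇒ay≡cx g eq))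

  swaps-∞⇒xx′+1≡-bc : ∀ g {x x′ y} .{{_ : NonZero y}} → act g (x , y) ∼ ∞ → act g ∞ ∼ (x′ , y) →
                      ∣ SL2Z.c g ∣ ≡ ∣ y ∣ → x * x′ + 1ℤ ≡ - SL2Z.b g * SL2Z.c g
  swaps-∞⇒xx′+1≡-bc g@(mkSL2Z a b c d det) {x} {x′} {y} eq eq′ ∣c∣≡∣y∣ =
    *-cancelʳ-≡ _ _ (y * y) {{i*j≢0 y y}} (begin
      (x * x′ + 1ℤ) * (y * y)
        ≡⟨ cong (λ t → (x * x′ + t) * (y * y)) det ⟨
      (x * x′ + (a * d - b * c)) * (y * y)
        ≡⟨ solve (a ∷ b ∷ c ∷ d ∷ x ∷ x′ ∷ y ∷ []) ⟩
      x * x′ * (y * y) + a * y * (d * y) - b * c * (y * y)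
        ≡⟨ cong₂ (λ s t → x * x′ * (y * y) + s * t - b * c * (y * y))
                 (sends-∞-to⇒ay≡cx g eq′) (sends-to-∞⇒dy≡-cx g eq) ⟩
      x * x′ * (y * y) + c * x′ * - (c * x) - b * c * (y * y)
        ≡⟨ solve (b ∷ c ∷ x ∷ x′ ∷ y ∷ []) ⟩
      x * x′ * (y * y - c * c) + - b * c * (y * y)
        ≡⟨ cong (λ t → x * x′ * (y * y - t) + - b * c * (y * y)) (∣i∣≡∣j∣⇒i*i≡j*j c y ∣c∣≡∣y∣) ⟩
      x * x′ * (y * y - y * y) + - b * c * (y * y)
        ≡⟨ solve (b ∷ c ∷ x ∷ x′ ∷ y ∷ []) ⟩
      - b * c * (y * y)
        ∎)

  swaps-∞⇒q₁≡q₂∧q₁∣p₁p₂+1 : ∀ g {p₁ q₁ p₂ q₂} .{{_ : ℕ.NonZero q₁}} →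
    act g (frac p₁ q₁) ∼ ∞ → act g ∞ ∼ frac p₂ q₂ → ℕ.Coprime p₁ q₁ → ℕ.Coprime p₂ q₂ →
    q₁ ≡ q₂ × q₁ ℕ.∣ p₁ ℕ.* p₂ ℕ.+ 1
  swaps-∞⇒q₁≡q₂∧q₁∣p₁p₂+1 g@(mkSL2Z a b c d _) {p₁} {q₁} {p₂} {q₂} eq eq′ p₁⊥q₁ p₂⊥q₂ =
    q₁≡q₂ , ℕ.divides ∣ - b ∣ (begin
    p₁ ℕ.* p₂ ℕ.+ 1        ≡⟨ cong ∣_∣ (pos-*+1 p₁ p₂) ⟩
    ∣ + p₁ * + p₂ + 1ℤ ∣   ≡⟨ cong ∣_∣ (swaps-∞⇒xx′+1≡-bc g eq eq″ ∣c∣≡q₁) ⟩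
    ∣ - b * c ∣            ≡⟨ abs-* (- b) c ⟩
    ∣ - b ∣ ℕ.* ∣ c ∣      ≡⟨ cong (∣ - b ∣ ℕ.*_) ∣c∣≡q₁ ⟩
    ∣ - b ∣ ℕ.* q₁         ∎)
    where
    ∣c∣≡q₁ : ∣ c ∣ ≡ q₁
    ∣c∣≡q₁ = sends-to-∞⇒∣c∣≡∣y∣ g eq (ℕ.sym p₁⊥q₁)
    q₁≡q₂ : q₁ ≡ q₂
    q₁≡q₂ = trans (sym ∣c∣≡q₁) (sends-∞-to⇒∣c∣≡∣y∣ g eq′ (ℕ.sym p₂⊥q₂))
    eq″ : act g ∞ ∼ frac p₂ q₁
    eq″ = subst (λ q → act g ∞ ∼ frac p₂ q) (sym q₁≡q₂) eq′

  swapping-matrix : ∀ x x′ y k → x * x′ + 1ℤ ≡ k * y → SL2Z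
  swapping-matrix x x′ y k eq = mkSL2Z x′ (- k) y (- x) (begin
    x′ * - x - - k * y   ≡⟨ solve (x ∷ x′ ∷ y ∷ k ∷ []) ⟩
    k * y - x * x′       ≡⟨ cong (_- x * x′) eq ⟨
    x * x′ + 1ℤ - x * x′ ≡⟨ solve (x ∷ x′ ∷ []) ⟩
    1ℤ                   ∎)

  swapping-matrix-swaps : ∀ x x′ y k (eq : x * x′ + 1ℤ ≡ k * y) →
                          MapsOnto (swapping-matrix x x′ y k eq) ((x , y) , ∞) ((x′ , y) , ∞)
  swapping-matrix-swaps x x′ y k eq = inj₂ (xy↦∞ , ∞↦x′y)
    where
    xy↦∞ : (x′ * x + - k * y) * 0ℤ ≡ (y * x + - x * y) * 1ℤ
    xy↦∞ = solve (x ∷ x′ ∷ y ∷ k ∷ [])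
    ∞↦x′y : (x′ * 1ℤ + - k * 0ℤ) * y ≡ (y * 1ℤ + - x * 0ℤ) * x′
    ∞↦x′y = solve (x ∷ x′ ∷ y ∷ k ∷ [])

  sameProjection-γ̄⇒ : ∀ {p₁ q₁ p₂ q₂} → p₁ ℕ.< q₁ → p₂ ℕ.< q₂ → ℕ.Coprime p₁ q₁ → ℕ.Coprime p₂ q₂ →
                      SameProjection (γ̄ p₁ q₁) (γ̄ p₂ q₂) →
                      p₁ ℕ.* q₂ ≡ p₂ ℕ.* q₁ ⊎ (q₁ ≡ q₂ × q₁ ℕ.∣ p₁ ℕ.* p₂ ℕ.+ 1)
  sameProjection-γ̄⇒ p₁<q₁ p₂<q₂ _ _ (g , inj₁ (eq , fix)) =
    inj₁ (fixes-∞⇒same-fraction g fix eq p₁<q₁ p₂<q₂)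
  sameProjection-γ̄⇒ p₁<q₁ _ p₁⊥q₁ p₂⊥q₂ (g , inj₂ (eq , eq′)) =
    inj₂ (swaps-∞⇒q₁≡q₂∧q₁∣p₁p₂+1 g {{<⇒nonZero p₁<q₁}} eq eq′ p₁⊥q₁ p₂⊥q₂)

  sameProjection-γ̄⇐ : ∀ {p₁ p₂ q} → q ℕ.∣ p₁ ℕ.* p₂ ℕ.+ 1 → SameProjection (γ̄ p₁ q) (γ̄ p₂ q)
  sameProjection-γ̄⇐ {p₁} {p₂} {q} (ℕ.divides k eq) =
    swapping-matrix (+ p₁) (+ p₂) (+ q) (+ k) eq′ , swapping-matrix-swaps (+ p₁) (+ p₂) (+ q) (+ k) eq′
    where
    eq′ : + p₁ * + p₂ + 1ℤ ≡ + k * + q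
    eq′ = trans (sym (pos-*+1 p₁ p₂)) (trans (cong +_ eq) (pos-* k q))

open import Data.Nat using (ℕ; _<_; _≤_; _*_; _+_)
open import Data.Nat.Coprimality using (Coprime)
open import Data.Nat.Divisibility using (_∣_)
open import Function.Bundles using (_⇔_; mk⇔)
open import Relation.Nullary using (¬_)
open import Data.Empty using (⊥-elim)
open import Function.Base using (_∘_; id)

mainTheorem2 : (p₁ q₁ p₂ q₂ : ℕ) →
    0 < p₁ → p₁ < q₁ → Coprime p₁ q₁ → 2 ≤ q₁ →
    0 < p₂ → p₂ < q₂ → Coprime p₂ q₂ → 2 ≤ q₂ →
    ¬ (p₁ * q₂ ≡ p₂ * q₁) →
    SameProjection (γ̄ p₁ q₁) (γ̄ p₂ q₂) ⇔ (q₁ ≡ q₂ × q₁ ∣ p₁ * p₂ + 1)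
mainTheorem2 p₁ q₁ p₂ q₂ _ p₁<q₁ p₁⊥q₁ _ _ p₂<q₂ p₂⊥q₂ _ w₁≢w₂ = mk⇔
  ([ ⊥-elim ∘ w₁≢w₂ , id ]′ ∘ sameProjection-γ̄⇒ p₁<q₁ p₂<q₂ p₁⊥q₁ p₂⊥q₂)
  (λ { (refl , q∣p₁p₂+1) → sameProjection-γ̄⇐ q∣p₁p₂+1 })
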